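{- Let $t\in\mathbb{Z}^+$ and let $P$ be any $\mathcal{C}_t^{(\mu_0,\mu_1)}$-hard problem. Then for any $(\alpha,\beta,\gamma)$-competitive (deterministic) algorithm for $P$ with respect to $(\mu_0,\mu_1)$: (i) $\alpha+\beta\geq t$, and (ii) $\alpha+(t-1)\gamma\geq t$.
   Context: Setting: online minimization problems with binary predictions; an instance is $I=(x,\hat x,r)$ with request sequence $r=\langle r_1,\dots,r_n\rangle$, $x\in\{0,1\}^n$ encoding a fixed optimal solution, $\hat x\in\{0,1\}^n$ its prediction, with $\hat x_i$ revealed together with $r_i$. Error measures: $\mu_0(I)=\sum_i x_i(1-\hat x_i)$ and $\mu_1(I)=\sum_i(1-x_i)\hat x_i$. A deterministic online algorithm is $(\alpha,\beta,\gamma)$-competitive w.r.t. $(\mu_0,\mu_1)$ if there is a constant $\kappa$ with $\mathrm{Alg}(I)\le\alpha\,\mathrm{Opt}(I)+\beta\,\mu_0(I)+\gamma\,\mu_1(I)+\kappa$ for all $I$. $Q$ is as hard as $P$ if existence of an $(\alpha,\beta,\gamma)$-competitive algorithm for $Q$ w.r.t. $(\mu_0,\mu_1)$ implies existence of one for $P$ w.r.t. $(\mu_0,\mu_1)$. $\mathrm{ASG}_t$: each request $r_i$ prompts an output bit $y_i$, with $\hat x_i$ revealed together with $r_i$; $x$ is revealed after the last request; cost $\sum_i(y_i+t\,x_i(1-y_i))$. A problem $P$ is $\mathcal{C}_t^{(\mu_0,\mu_1)}$-hard if $P$ is as hard as $\mathrm{ASG}_t$.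
   Formalization: The parameters α, β, γ, the constant κ, and the values of Opt and of every algorithm's cost are rational. -}

module Defs where

open import Data.Bool using (Bool; true; false)
open import Data.Nat as ℕ using (ℕ; zero; suc)
open import Data.List using (List; []; _∷_)
open import Data.Vec using (Vec; []; _∷_)
open import Data.Product using (Σ; Σ-syntax; ∃; _×_; _,_)
open import Data.Rational using (ℚ; _+_; _*_; _≤_; _/_)
open import Data.Integer using (+_)

bit : Bool → ℕ
bit true  = 1
bit false = 0

ℕtoℚ : ℕ → ℚ
ℕtoℚ n = (+ n) / 1

mu0 : ∀ {n} → Vec Bool n → Vec Bool n → ℕ
mu0 []            []            = 0
mu0 (true ∷ xs)   (false ∷ hs)  = suc (mu0 xs hs)
mu0 (_ ∷ xs)      (_ ∷ hs)      = mu0 xs hs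

mu1 : ∀ {n} → Vec Bool n → Vec Bool n → ℕ
mu1 []            []            = 0
mu1 (false ∷ xs)  (true ∷ hs)   = suc (mu1 xs hs)
mu1 (_ ∷ xs)      (_ ∷ hs)      = mu1 xs hs

-- An online minimization problem with binary predictions, abstractly:
-- a type of instances I = (x, x̂, r) (each with a length n, the optimal
-- solution x and its prediction x̂), the optimal value Opt(I), a type of
-- deterministic online algorithms, and their cost Alg(I).
record Problem : Set₁ where
  field
    Inst : Set
    len  : Inst → ℕ
    sol  : (I : Inst) → Vec Bool (len I)
    pred : (I : Inst) → Vec Bool (len I)
    opt  : Inst → ℚ
    Algo : Set
    cost : Algo → Inst → ℚ

  μ₀ : Inst → ℕ
  μ₀ I = mu0 (sol I) (pred I)

  μ₁ : Inst → ℕ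
  μ₁ I = mu1 (sol I) (pred I)

open Problem public

Competitive : (P : Problem) → ℚ → ℚ → ℚ → Algo P → Set
Competitive P α β γ A =
  Σ[ κ ∈ ℚ ] ((I : Inst P) →
    cost P A I ≤ α * opt P I + β * ℕtoℚ (μ₀ P I) + γ * ℕtoℚ (μ₁ P I) + κ)

HasCompetitive : Problem → ℚ → ℚ → ℚ → Set
HasCompetitive P α β γ = Σ[ A ∈ Algo P ] Competitive P α β γ A

AsHardAs : Problem → Problem → Set
AsHardAs Q P = (α β γ : ℚ) → HasCompetitive Q α β γ → HasCompetitive P α β γ

asgCost : ℕ → ∀ {n} → Vec Bool n → Vec Bool n → ℕ
asgCost t []           []           = 0
asgCost t (true ∷ ys)  (_ ∷ xs)     = suc (asgCost t ys xs)
asgCost t (false ∷ ys) (true ∷ xs)  = t ℕ.+ asgCost t ys xs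
asgCost t (false ∷ ys) (false ∷ xs) = asgCost t ys xs

-- A deterministic online algorithm for ASG: on request r_i it sees the
-- predictions x̂_i, x̂_{i-1}, …, x̂_1 (most recent first) and outputs y_i.
-- (Requests carry no other information; earlier outputs are recomputable.)
ASGAlgo : Set
ASGAlgo = List Bool → Bool

runASG : ASGAlgo → List Bool → ∀ {n} → Vec Bool n → Vec Bool n
runASG A acc []       = []
runASG A acc (h ∷ hs) = A (h ∷ acc) ∷ runASG A (h ∷ acc) hs

ASGInst : Set
ASGInst = Σ[ n ∈ ℕ ] (Vec Bool n × Vec Bool n)

ASG : ℕ → Problem
ASG t = record
  { Inst = ASGInst
  ; len  = λ { (n , _ , _) → n }
  ; sol  = λ { (n , x , _) → x }
  ; pred = λ { (n , _ , h) → h }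
  ; opt  = λ { (n , x , _) → ℕtoℚ (asgCost t x x) }
  ; Algo = ASGAlgo
  ; cost = λ { A (n , x , h) → ℕtoℚ (asgCost t (runASG A [] h) x) }
  }

CtHard : ℕ → Problem → Set
CtHard t P = AsHardAs P (ASG t)

-- Adversary argument against ASG_{1+t}, to which P reduces by hardness. The adversary
-- predicts a constant bit b and, once the algorithm has output y, fixes the true bit to c y.
-- If every request then cost the algorithm strictly more than its own share of
-- α·Opt + β·μ₀ + γ·μ₁, the excess would grow linearly in the number of requests and
-- eventually beat the additive constant κ; so against every (b, c) some output y is served
-- within its share. With b = 0 and c = not this gives 1 + t ≤ α + β (answering 0 to a true 1
-- costs 1 + t against a share α + β; answering 1 to a true 0 costs 1 against a share 0).
-- With b = 1, the responses "always 0", "always 1" and not give γ ≥ 0, then α ≥ 1 or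
-- α ≥ 1 + t, and γ ≥ 1 or α ≥ 1 + t; together these force α + t γ ≥ 1 + t.
module Submission where

open import Defs
open import Data.Bool using (Bool; true; false; not)
open import Data.Empty using (⊥-elim)
open import Data.Integer as ℤ using (-[1+_])
import Data.Integer.Properties as ℤ
import Data.List as List
open import Data.Nat as ℕ using (ℕ; suc)
import Data.Nat.Properties as ℕ
open import Data.Product using (∃-syntax; _×_; _,_)
open import Data.Rational
  using (ℚ; mkℚ; 0ℚ; 1ℚ; _+_; _*_; _-_; -_; 1/_; _⊓_; _≤_; _<_; toℚᵘ; Positive; NonZero; NonNegative; positive)
open import Data.Rational.Properties
open import Data.Rational.Solver using (module +-*-Solver)
import Data.Rational.Unnormalised as ℚᵘ
import Data.Rational.Unnormalised.Properties as ℚᵘ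
open import Data.Sum using (_⊎_; inj₁; inj₂)
open import Data.Vec using (Vec; []; _∷_; [_]; map; replicate)
open import Function using (case_of_)
open import Relation.Binary.PropositionalEquality
  using (_≡_; module ≡-Reasoning; refl; sym; trans; cong; cong₂; subst; subst₂)
open import Relation.Nullary using (¬_; yes; no)

ℕtoℚ-homo-+ : ∀ m n → ℕtoℚ (m ℕ.+ n) ≡ ℕtoℚ m + ℕtoℚ n
ℕtoℚ-homo-+ m n = toℚᵘ-injective (begin
  toℚᵘ (ℕtoℚ (m ℕ.+ n))            ≈⟨ toℚᵘ-fromℚᵘ (ι (m ℕ.+ n)) ⟩
  ι (m ℕ.+ n)                      ≈⟨ ℚᵘ.*≡* (cong (ℤ._* ℤ.+ 1) numerators) ⟩
  ι m ℚᵘ.+ ι n                     ≈⟨ ℚᵘ.≃-sym (ℚᵘ.+-cong (toℚᵘ-fromℚᵘ (ι m)) (toℚᵘ-fromℚᵘ (ι n))) ⟩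
  toℚᵘ (ℕtoℚ m) ℚᵘ.+ toℚᵘ (ℕtoℚ n) ≈⟨ ℚᵘ.≃-sym (toℚᵘ-homo-+ (ℕtoℚ m) (ℕtoℚ n)) ⟩
  toℚᵘ (ℕtoℚ m + ℕtoℚ n)           ∎)
  where
  open ℚᵘ.≃-Reasoning
  -- ℕtoℚ k is definitionally fromℚᵘ (ι k).
  ι : ℕ → ℚᵘ.ℚᵘ
  ι k = ℚᵘ.mkℚᵘ (ℤ.+ k) 0
  numerators : ℤ.+ (m ℕ.+ n) ≡ ℤ.+ m ℤ.* ℤ.+ 1 ℤ.+ ℤ.+ n ℤ.* ℤ.+ 1
  numerators = trans (ℤ.pos-+ m n) (sym (cong₂ ℤ._+_ (ℤ.*-identityʳ (ℤ.+ m)) (ℤ.*-identityʳ (ℤ.+ n))))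

ℕtoℚ-unbounded : ∀ p → ∃[ m ] p < ℕtoℚ m
ℕtoℚ-unbounded p@(mkℚ -[1+ _ ] _ _) = 0 , negative⁻¹ p
ℕtoℚ-unbounded (mkℚ (ℤ.+ k) d-1 _) = suc k ,
  toℚᵘ-cancel-< (ℚᵘ.<-respʳ-≃ (ℚᵘ.≃-sym (toℚᵘ-fromℚᵘ (ℚᵘ.mkℚᵘ (ℤ.+ suc k) 0)))
                               (ℚᵘ.*<* k<[1+k][1+d]))
  where
  k<[1+k][1+d] : ℤ.+ k ℤ.* ℤ.+ 1 ℤ.< ℤ.+ suc k ℤ.* ℤ.+ suc d-1
  k<[1+k][1+d] = subst₂ ℤ._<_ (sym (ℤ.*-identityʳ (ℤ.+ k))) (ℤ.pos-* (suc k) (suc d-1))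
    (ℤ.+<+ (ℕ.<-≤-trans (ℕ.n<1+n k) (ℕ.m≤m*n (suc k) (suc d-1))))

archimedean : ∀ κ δ → 0ℚ < δ → ∃[ n ] κ < ℕtoℚ n * δ
archimedean κ δ 0<δ = let n , κ/δ<n = ℕtoℚ-unbounded (κ * 1/ δ) in n , (begin-strict
  κ             ≡⟨ sym κ/δ*δ≡κ ⟩
  κ * 1/ δ * δ  <⟨ *-monoˡ-<-pos δ κ/δ<n ⟩
  ℕtoℚ n * δ    ∎)
  where
  open ≤-Reasoning
  instance
    δ-positive : Positive δ
    δ-positive = positive 0<δ
    δ-nonZero : NonZero δ
    δ-nonZero = pos⇒nonZero δ
  κ/δ*δ≡κ : κ * 1/ δ * δ ≡ κ
  κ/δ*δ≡κ = trans (*-assoc κ (1/ δ) δ) (trans (cong (κ *_) (*-inverseˡ δ)) (*-identityʳ κ))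

ℕtoℚ-split : ∀ {m} n k → m ≡ n ℕ.+ k → ℕtoℚ m ≡ ℕtoℚ n + ℕtoℚ k
ℕtoℚ-split n k refl = ℕtoℚ-homo-+ n k

ℕtoℚ-nonNeg : ∀ n → NonNegative (ℕtoℚ n)
ℕtoℚ-nonNeg n = normalize-nonNeg n 1

p<q⇒0<q-p : ∀ {p q} → p < q → 0ℚ < q - p
p<q⇒0<q-p {p} {q} p<q = subst (_< q - p) (+-inverseʳ p) (+-monoˡ-< (- p) p<q)

p≤q-r⇒p+r≤q : ∀ {p q r} → p ≤ q - r → p + r ≤ q
p≤q-r⇒p+r≤q {p} {q} {r} p≤q-r = subst (p + r ≤_) q-r+r≡q (+-monoˡ-≤ r p≤q-r)
  where
  q-r+r≡q : q - r + r ≡ q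
  q-r+r≡q = trans (+-assoc q (- r) r) (trans (cong (q +_) (+-inverseˡ r)) (+-identityʳ q))

⊓-glb-< : ∀ {p q r} → r < p → r < q → r < p ⊓ q
⊓-glb-< {p} {q} r<p r<q with ⊓-sel p q
... | inj₁ p⊓q≡p = subst (_ <_) (sym p⊓q≡p) r<p
... | inj₂ p⊓q≡q = subst (_ <_) (sym p⊓q≡q) r<q

uniform-margin : ∀ (p q : Bool → ℚ) → (∀ y → p y < q y) → ∃[ δ ] 0ℚ < δ × ∀ y → δ + p y ≤ q y
uniform-margin p q p<q = gap true ⊓ gap false , ⊓-glb-< (0<gap true) (0<gap false) , margin
  where
  gap : Bool → ℚ
  gap y = q y - p y
  0<gap : ∀ y → 0ℚ < gap y
  0<gap y = p<q⇒0<q-p (p<q y)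
  margin : ∀ y → gap true ⊓ gap false + p y ≤ q y
  margin true  = p≤q-r⇒p+r≤q (p⊓q≤p (gap true) (gap false))
  margin false = p≤q-r⇒p+r≤q (p⊓q≤q (gap true) (gap false))

1+τ≤α+τγ : ∀ {α γ} τ .{{_ : NonNegative τ}} → 0ℚ ≤ γ → (1ℚ ≤ α × 1ℚ ≤ γ) ⊎ 1ℚ + τ ≤ α →
           1ℚ + τ ≤ α + τ * γ
1+τ≤α+τγ {α} {γ} τ 0≤γ (inj₁ (1≤α , 1≤γ)) = begin
  1ℚ + τ       ≡⟨ cong (1ℚ +_) (sym (*-identityʳ τ)) ⟩
  1ℚ + τ * 1ℚ  ≤⟨ +-mono-≤ 1≤α (*-monoˡ-≤-nonNeg τ 1≤γ) ⟩
  α + τ * γ    ∎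
  where open ≤-Reasoning
1+τ≤α+τγ {α} {γ} τ 0≤γ (inj₂ 1+τ≤α) = begin
  1ℚ + τ           ≡⟨ sym (trans (cong (1ℚ + τ +_) (*-zeroʳ τ)) (+-identityʳ (1ℚ + τ))) ⟩
  1ℚ + τ + τ * 0ℚ  ≤⟨ +-mono-≤ 1+τ≤α (*-monoˡ-≤-nonNeg τ 0≤γ) ⟩
  α + τ * γ        ∎
  where open ≤-Reasoning

asgCost-∷ : ∀ T {n} y x (ys xs : Vec Bool n) →
            asgCost T (y ∷ ys) (x ∷ xs) ≡ asgCost T [ y ] [ x ] ℕ.+ asgCost T ys xs
asgCost-∷ T true  _     ys xs = refl
asgCost-∷ T false true  ys xs = cong (ℕ._+ asgCost T ys xs) (sym (ℕ.+-identityʳ T))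
asgCost-∷ T false false ys xs = refl

mu0-∷ : ∀ {n} x h (xs hs : Vec Bool n) → mu0 (x ∷ xs) (h ∷ hs) ≡ mu0 [ x ] [ h ] ℕ.+ mu0 xs hs
mu0-∷ true  true  xs hs = refl
mu0-∷ true  false xs hs = refl
mu0-∷ false true  xs hs = refl
mu0-∷ false false xs hs = refl

mu1-∷ : ∀ {n} x h (xs hs : Vec Bool n) → mu1 (x ∷ xs) (h ∷ hs) ≡ mu1 [ x ] [ h ] ℕ.+ mu1 xs hs
mu1-∷ true  true  xs hs = refl
mu1-∷ true  false xs hs = refl
mu1-∷ false true  xs hs = refl
mu1-∷ false false xs hs = refl

module ASGBound (T : ℕ) (α β γ : ℚ) where

  open +-*-Solver

  linear : ℚ → ℚ → ℚ → ℚ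
  linear o e f = α * o + β * e + γ * f

  linear-+ : ∀ o e f o′ e′ f′ → linear (o + o′) (e + e′) (f + f′) ≡ linear o e f + linear o′ e′ f′
  linear-+ = solve 9 (λ a b g o e f o′ e′ f′ →
      a :* (o :+ o′) :+ b :* (e :+ e′) :+ g :* (f :+ f′)
    := (a :* o :+ b :* e :+ g :* f) :+ (a :* o′ :+ b :* e′ :+ g :* f′)) refl α β γ

  bound : ∀ {n} → Vec Bool n → Vec Bool n → ℚ
  bound x x̂ = linear (ℕtoℚ (asgCost T x x)) (ℕtoℚ (mu0 x x̂)) (ℕtoℚ (mu1 x x̂))

  bound-∷ : ∀ {n} x h (xs hs : Vec Bool n) → bound (x ∷ xs) (h ∷ hs) ≡ bound [ x ] [ h ] + bound xs hs
  bound-∷ x h xs hs = begin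
    bound (x ∷ xs) (h ∷ hs)
      ≡⟨ cong-linear (ℕtoℚ-split o₁ o (asgCost-∷ T x x xs xs))
                     (ℕtoℚ-split e₁ e (mu0-∷ x h xs hs)) (ℕtoℚ-split f₁ f (mu1-∷ x h xs hs)) ⟩
    linear (ℕtoℚ o₁ + ℕtoℚ o) (ℕtoℚ e₁ + ℕtoℚ e) (ℕtoℚ f₁ + ℕtoℚ f)
      ≡⟨ linear-+ (ℕtoℚ o₁) (ℕtoℚ e₁) (ℕtoℚ f₁) (ℕtoℚ o) (ℕtoℚ e) (ℕtoℚ f) ⟩
    bound [ x ] [ h ] + bound xs hs ∎
    where
    open ≡-Reasoning
    o₁ = asgCost T [ x ] [ x ]; e₁ = mu0 [ x ] [ h ]; f₁ = mu1 [ x ] [ h ]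
    o  = asgCost T xs xs;       e  = mu0 xs hs;       f  = mu1 xs hs
    cong-linear : ∀ {o o′ e e′ f f′} → o ≡ o′ → e ≡ e′ → f ≡ f′ → linear o e f ≡ linear o′ e′ f′
    cong-linear refl refl refl = refl

  requestBound : Bool → Bool → ℚ
  requestBound true  true  = α
  requestBound true  false = α + β
  requestBound false true  = γ
  requestBound false false = 0ℚ

  bound-[] : ∀ x h → bound [ x ] [ h ] ≡ requestBound x h
  bound-[] true  true  = solve 3 (λ a b g → a :* con 1ℚ :+ b :* con 0ℚ :+ g :* con 0ℚ := a) refl α β γ
  bound-[] true  false = solve 3 (λ a b g → a :* con 1ℚ :+ b :* con 1ℚ :+ g :* con 0ℚ := a :+ b) refl α β γ
  bound-[] false true  = solve 3 (λ a b g → a :* con 0ℚ :+ b :* con 0ℚ :+ g :* con 1ℚ := g) refl α β γ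
  bound-[] false false = solve 3 (λ a b g → a :* con 0ℚ :+ b :* con 0ℚ :+ g :* con 0ℚ := con 0ℚ) refl α β γ

  margin-accumulates : ∀ b (c : Bool → Bool) δ →
    (∀ y → δ + requestBound (c y) b ≤ ℕtoℚ (asgCost T [ y ] [ c y ])) →
    ∀ {n} (ys : Vec Bool n) →
    ℕtoℚ n * δ + bound (map c ys) (replicate n b) ≤ ℕtoℚ (asgCost T ys (map c ys))
  margin-accumulates b c δ margin [] = ≤-reflexive
    (solve 4 (λ d a b g → con 0ℚ :* d :+ (a :* con 0ℚ :+ b :* con 0ℚ :+ g :* con 0ℚ) := con 0ℚ)
           refl δ α β γ)
  margin-accumulates b c δ margin {suc n} (y ∷ ys) = begin
    ℕtoℚ (suc n) * δ + bound (c y ∷ xs) (b ∷ hs)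
      ≡⟨ cong₂ (λ k s → k * δ + s) (ℕtoℚ-homo-+ 1 n)
               (trans (bound-∷ (c y) b xs hs) (cong (_+ bound xs hs) (bound-[] (c y) b))) ⟩
    (1ℚ + ℕtoℚ n) * δ + (requestBound (c y) b + bound xs hs)
      ≡⟨ solve 4 (λ k d s S → (con 1ℚ :+ k) :* d :+ (s :+ S) := (d :+ s) :+ (k :* d :+ S))
               refl (ℕtoℚ n) δ (requestBound (c y) b) (bound xs hs) ⟩
    (δ + requestBound (c y) b) + (ℕtoℚ n * δ + bound xs hs)
      ≤⟨ +-mono-≤ (margin y) (margin-accumulates b c δ margin ys) ⟩
    ℕtoℚ (asgCost T [ y ] [ c y ]) + ℕtoℚ (asgCost T ys xs)
      ≡⟨ sym (ℕtoℚ-split (asgCost T [ y ] [ c y ]) (asgCost T ys xs) (asgCost-∷ T y (c y) ys xs)) ⟩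
    ℕtoℚ (asgCost T (y ∷ ys) (c y ∷ xs)) ∎
    where
    open ≤-Reasoning
    xs = map c ys
    hs = replicate n b

  no-uniform-excess : ∀ {B} → Competitive (ASG T) α β γ B → ∀ b c →
                      ¬ (∀ y → requestBound (c y) b < ℕtoℚ (asgCost T [ y ] [ c y ]))
  no-uniform-excess {B} (κ , competitive) b c beyond =
    let δ , 0<δ , margin = uniform-margin (λ y → requestBound (c y) b)
                                          (λ y → ℕtoℚ (asgCost T [ y ] [ c y ])) beyond
        n , κ<nδ = archimedean κ δ 0<δ
        hs = replicate n b
        ys = runASG B List.[] hs
        xs = map c ys
    in <-irrefl refl (begin-strict
      ℕtoℚ (asgCost T ys xs)     ≤⟨ competitive (n , xs , hs) ⟩
      bound xs hs + κ            <⟨ +-monoʳ-< (bound xs hs) κ<nδ ⟩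
      bound xs hs + ℕtoℚ n * δ   ≡⟨ +-comm (bound xs hs) (ℕtoℚ n * δ) ⟩
      ℕtoℚ n * δ + bound xs hs   ≤⟨ margin-accumulates b c δ margin ys ⟩
      ℕtoℚ (asgCost T ys xs)     ∎)
    where open ≤-Reasoning

  some-request-within-bound : ∀ {B} → Competitive (ASG T) α β γ B → ∀ b c →
                              ∃[ y ] ℕtoℚ (asgCost T [ y ] [ c y ]) ≤ requestBound (c y) b
  some-request-within-bound comp b c =
    case ℕtoℚ (asgCost T [ true ] [ c true ]) ≤? requestBound (c true) b of λ where
      (yes within) → true , within
      (no  beyond) → false , ≮⇒≥ λ beyond′ → no-uniform-excess comp b c λ where
        true  → ≰⇒> beyond
        false → beyond′

module _ (t : ℕ) (α β γ : ℚ) {B : ASGAlgo} (comp : Competitive (ASG (suc t)) α β γ B) where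

  open ASGBound (suc t) α β γ

  miss-cost : ℕtoℚ (asgCost (suc t) [ false ] [ true ]) ≡ ℕtoℚ (suc t)
  miss-cost = cong ℕtoℚ (ℕ.+-identityʳ (suc t))

  ASG-competitive⇒1+t≤α+β : ℕtoℚ (suc t) ≤ α + β
  ASG-competitive⇒1+t≤α+β = case some-request-within-bound comp false not of λ where
    (true  , 1≤0)      → ⊥-elim (<-irrefl refl (<-≤-trans (positive⁻¹ 1ℚ) 1≤0))
    (false , miss≤α+β) → subst (_≤ α + β) miss-cost miss≤α+β

  ASG-competitive⇒1+t≤α+tγ : ℕtoℚ (suc t) ≤ α + ℕtoℚ t * γ
  ASG-competitive⇒1+t≤α+tγ = subst (_≤ α + ℕtoℚ t * γ) (sym 1+t)
    (1+τ≤α+τγ (ℕtoℚ t) {{ℕtoℚ-nonNeg t}} 0≤γ cases)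
    where
    1+t : ℕtoℚ (suc t) ≡ 1ℚ + ℕtoℚ t
    1+t = ℕtoℚ-homo-+ 1 t
    0≤γ : 0ℚ ≤ γ
    0≤γ = case some-request-within-bound comp true (λ _ → false) of λ where
      (true  , 1≤γ) → ≤-trans (nonNegative⁻¹ 1ℚ) 1≤γ
      (false , 0≤γ) → 0≤γ
    cases : (1ℚ ≤ α × 1ℚ ≤ γ) ⊎ 1ℚ + ℕtoℚ t ≤ α
    cases = case some-request-within-bound comp true (λ _ → true)
               , some-request-within-bound comp true not of λ where
      ((false , miss≤α) , _)                → inj₂ (subst (_≤ α) (trans miss-cost 1+t) miss≤α)
      ((true  , _)      , (false , miss≤α)) → inj₂ (subst (_≤ α) (trans miss-cost 1+t) miss≤α)
      ((true  , 1≤α)    , (true  , 1≤γ))    → inj₁ (1≤α , 1≤γ)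

theorem58 : (t : ℕ) → (P : Problem) → CtHard (suc t) P →
    (α β γ : ℚ) → (A : Algo P) → Competitive P α β γ A →
    (ℕtoℚ (suc t) ≤ α + β) × (ℕtoℚ (suc t) ≤ α + ℕtoℚ t * γ)
theorem58 t P hard α β γ A comp =
  let _ , compB = hard α β γ (A , comp) in
  ASG-competitive⇒1+t≤α+β t α β γ compB , ASG-competitive⇒1+t≤α+tγ t α β γ compB
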